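{- Let $S$ be a numerical semigroup. Then $\mathrm{C}(S)=2$ if and only if $S$ is elementary and not ordinary.
   Context: A numerical semigroup is a subset $S\subseteq\mathbb{N}$ containing $0$, closed under addition, with finite complement in $\mathbb{N}$; $\mathrm{F}(S)=\max(\mathbb{Z}\setminus S)$ and $\mathrm{m}(S)=\min(S\setminus\{0\})$. $S$ is ordinary if $S=\{0\}\cup\{x\in\mathbb{N}\mid x\ge\mathrm{m}(S)\}$, and elementary if $\mathrm{F}(S)<2\,\mathrm{m}(S)$. An ideal of a numerical semigroup $\Delta$ is a nonempty $I\subseteq\Delta$ with $I+\Delta\subseteq I$; $\mathcal{J}(\Delta)$ is the set of numerical semigroups $T$ with $T\setminus\{0\}$ an ideal of $\Delta$; $\mathcal{J}(\mathscr{F})=\bigcup_{\Delta\in\mathscr{F}}\mathcal{J}(\Delta)$; $\mathcal{J}^0(\mathbb{N})=\{\mathbb{N}\}$, $\mathcal{J}^{k+1}(\mathbb{N})=\mathcal{J}(\mathcal{J}^k(\mathbb{N}))$; the complexity is $\mathrm{C}(S)=\min\{k\in\mathbb{N}\mid S\in\mathcal{J}^k(\mathbb{N})\}$. -}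

module Defs where

open import Data.Nat using (ℕ; zero; suc; _+_; _*_; _≤_; _<_)
open import Data.Integer as ℤ using (ℤ; +_; -[1+_])
open import Data.Bool using (Bool; true; false)
open import Data.Product using (Σ; ∃; ∃-syntax; _×_; _,_)
open import Data.Sum using (_⊎_)
open import Data.Empty using (⊥)
open import Relation.Nullary using (¬_)
open import Relation.Binary.PropositionalEquality using (_≡_)
open import Function.Bundles using (_⇔_)

record NumericalSemigroup : Set where
  field
    mem      : ℕ → Bool
    has-zero : mem 0 ≡ true
    closed   : ∀ x y → mem x ≡ true → mem y ≡ true → mem (x + y) ≡ true
    cofinite : ∃[ N ] (∀ x → N ≤ x → mem x ≡ true)

open NumericalSemigroup public

_∈S_ : ℕ → NumericalSemigroup → Set
x ∈S S = mem S x ≡ true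

_∈ℤS_ : ℤ → NumericalSemigroup → Set
(+ n) ∈ℤS S = n ∈S S
-[1+ n ] ∈ℤS S = ⊥

IsMultiplicity : NumericalSemigroup → ℕ → Set
IsMultiplicity S m = (1 ≤ m) × (m ∈S S) × (∀ y → 1 ≤ y → y < m → ¬ (y ∈S S))

IsFrobenius : NumericalSemigroup → ℤ → Set
IsFrobenius S f = ¬ (f ∈ℤS S) × (∀ z → f ℤ.< z → z ∈ℤS S)

Ordinary : NumericalSemigroup → Set
Ordinary S = ∃[ m ] (IsMultiplicity S m × (∀ x → (x ∈S S) ⇔ (x ≡ 0 ⊎ m ≤ x)))

Elementary : NumericalSemigroup → Set
Elementary S = ∃[ m ] ∃[ f ] (IsMultiplicity S m × IsFrobenius S f × f ℤ.< + (2 * m))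

-- T ∈ 𝒥(Δ): T \ {0} is an ideal of Δ
-- (nonempty, contained in Δ, and (T \ {0}) + Δ ⊆ T \ {0})
InJ : NumericalSemigroup → NumericalSemigroup → Set
InJ Δ T =
  (∃[ x ] (¬ (x ≡ 0) × x ∈S T))
  × (∀ x → ¬ (x ≡ 0) → x ∈S T → x ∈S Δ)
  × (∀ x y → ¬ (x ≡ 0) → x ∈S T → y ∈S Δ → (¬ (x + y ≡ 0) × (x + y) ∈S T))

InJk : ℕ → NumericalSemigroup → Set
InJk zero T = ∀ x → x ∈S T
InJk (suc k) T = ∃[ Δ ] (InJk k Δ × InJ Δ T)

HasComplexity : NumericalSemigroup → ℕ → Set
HasComplexity S k = InJk k S × (∀ j → j < k → ¬ InJk j S)

-- S ∈ 𝒥(Δ) makes S contain x + Δ for every nonzero x ∈ S.  Hence S ∈ 𝒥(ℕ) forces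
-- S ⊇ [m(S), ∞), i.e. S is ordinary, and S ∈ 𝒥(Δ) with Δ ∈ 𝒥(ℕ) forces
-- S ⊇ m(S) + [m(S), ∞), i.e. F(S) < 2 m(S).  Conversely, if F(S) < 2 m(S) then
-- S ∖ {0} is an ideal of the ordinary semigroup {0} ∪ [m(S), ∞), which lies in 𝒥(ℕ).
module Submission where

open import Defs
open import Data.Product using (_×_)
open import Relation.Nullary using (¬_)
open import Function.Bundles using (_⇔_)

open import Data.Nat using (ℕ; zero; suc; _+_; _*_; _≤_; _<_; _≟_; _≤?_; _<?_; z≤n; s≤s)
open import Data.Nat.Properties
open import Data.Nat.Induction using (<-rec)
open import Data.Integer as ℤ using (+_; -[1+_]; +<+; -<+; -<-; +≤+)
import Data.Integer.Properties as ℤ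
open import Data.Bool using (true) renaming (_≟_ to _≟ᵇ_)
open import Data.Product using (∃-syntax; _,_; proj₂)
open import Data.Sum using (_⊎_; inj₁; inj₂)
open import Function using (case_of_; _∘_)
open import Function.Bundles using (mk⇔; Equivalence)
open import Relation.Nullary using (Dec; yes; no; does; contradiction)
open import Relation.Nullary.Decidable using (dec-true; map′; _→-dec_; _⊎-dec_)
open import Relation.Unary using (Pred; Decidable)
open import Relation.Binary.PropositionalEquality using (_≡_; _≢_; refl; sym; subst)

module _ {p} {P : Pred ℕ p} (P? : Decidable P) where

  least : ∀ n → P n → ∃[ k ] (P k × (∀ {j} → j < k → ¬ P j))
  least = <-rec _ λ n below Pn → case anyUpTo? P? n of λ where
    (yes (j , j<n , Pj)) → below j<n Pj
    (no ∄j<n)            → n , Pn , λ {j} j<n Pj → ∄j<n (j , j<n , Pj)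

does-true⇒ : ∀ {a} {A : Set a} (a? : Dec A) → does a? ≡ true → A
does-true⇒ (yes a) _ = a

_∈S?_ : ∀ x S → Dec (x ∈S S)
x ∈S? S = mem S x ≟ᵇ true

multiplicity : ∀ S → ∃[ m ] IsMultiplicity S m
multiplicity S with cofinite S
... | N , cof with least (λ k → suc k ∈S? S) N (cof (suc N) (n≤1+n N))
... | k , sk∈S , minimal = suc k , s≤s z≤n , sk∈S , λ where
  (suc j) _ (s≤s j<k) → minimal j<k

≥-multiplicity : ∀ S {m x} → IsMultiplicity S m → x ≢ 0 → x ∈S S → m ≤ x
≥-multiplicity S {m} {x} (_ , _ , no-smaller) x≢0 x∈S with x <? m
... | yes x<m = contradiction x∈S (no-smaller x (n≢0⇒n>0 x≢0) x<m)
... | no x≮m  = ≮⇒≥ x≮m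

Conducts : NumericalSemigroup → ℕ → Set
Conducts S c = ∀ z → c ≤ z → z ∈S S

conducts? : ∀ S → Decidable (Conducts S)
conducts? S c with cofinite S
... | N , cof = map′ fromBounded toBounded (allUpTo? (λ j → (c ≤? j) →-dec (j ∈S? S)) N)
  where
  fromBounded : (∀ {j} → j < N → c ≤ j → j ∈S S) → Conducts S c
  fromBounded below z c≤z with z <? N
  ... | yes z<N = below z<N c≤z
  ... | no z≮N  = cof z (≮⇒≥ z≮N)
  toBounded : Conducts S c → ∀ {j} → j < N → c ≤ j → j ∈S S
  toBounded conducts _ = conducts _

conducts-pred : ∀ S {x} → x ∈S S → Conducts S (suc x) → Conducts S x
conducts-pred S x∈S conducts z x≤z with m≤n⇒m<n∨m≡n x≤z
... | inj₁ x<z  = conducts z x<z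
... | inj₂ refl = x∈S

-- F(S) is one below the least conductor c; c = 0 means S = ℕ and F(S) = -1.
frobenius : ∀ S → ∃[ f ] IsFrobenius S f
frobenius S with cofinite S
... | N , cof with least (conducts? S) N cof
... | zero , conducts , _ = -[1+ 0 ] , (λ ()) , λ where
  (+ z)    _          → conducts z z≤n
  -[1+ _ ] (-<- ())
... | suc c , conducts , minimal =
  + c , (λ c∈S → minimal ≤-refl (conducts-pred S c∈S conducts)) , λ where
    (+ z) (+<+ c<z) → conducts z c<z

gap<conductor : ∀ S {c g} → Conducts S c → ¬ (g ∈ℤS S) → g ℤ.< + c
gap<conductor S {g = -[1+ _ ]} _        _   = -<+
gap<conductor S {c} {+ g}      conducts g∉S with g <? c
... | yes g<c = +<+ g<c
... | no g≮c  = contradiction (conducts g (≮⇒≥ g≮c)) g∉S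

Frobenius<⇒conducts : ∀ S {f c} → IsFrobenius S f → f ℤ.< + c → Conducts S c
Frobenius<⇒conducts S (_ , above) f<c z c≤z = above (+ z) (ℤ.<-≤-trans f<c (+≤+ c≤z))

ℕˢ : NumericalSemigroup
ℕˢ = record { mem = λ _ → true ; has-zero = refl ; closed = λ _ _ _ _ → refl ; cofinite = 0 , λ _ _ → refl }

ordinary : ℕ → NumericalSemigroup
ordinary m = record
  { mem      = does ∘ member?
  ; has-zero = refl
  ; closed   = λ x y x∈ y∈ →
      dec-true (member? (x + y)) (+-closed (does-true⇒ (member? x) x∈) (does-true⇒ (member? y) y∈))
  ; cofinite = m , λ x m≤x → dec-true (member? x) (inj₂ m≤x)
  }
  where
  member? : ∀ x → Dec (x ≡ 0 ⊎ m ≤ x)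
  member? x = (x ≟ 0) ⊎-dec (m ≤? x)
  +-closed : ∀ {x y} → x ≡ 0 ⊎ m ≤ x → y ≡ 0 ⊎ m ≤ y → x + y ≡ 0 ⊎ m ≤ x + y
  +-closed         (inj₁ refl) y-member = y-member
  +-closed {x} {y} (inj₂ m≤x)  _        = inj₂ (≤-trans m≤x (m≤m+n x y))

∈ordinary⇔ : ∀ {m x} → x ∈S ordinary m ⇔ (x ≡ 0 ⊎ m ≤ x)
∈ordinary⇔ {m} {x} = mk⇔ (does-true⇒ (x ≟ 0 ⊎-dec m ≤? x)) (dec-true (x ≟ 0 ⊎-dec m ≤? x))

InJ-intro : ∀ Δ T {x} → x ≢ 0 → x ∈S T → (∀ x → x ≢ 0 → x ∈S T → x ∈S Δ) →
            (∀ x y → x ≢ 0 → x ∈S T → y ∈S Δ → (x + y) ∈S T) → InJ Δ T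
InJ-intro _ _ x≢0 x∈T T⊆Δ absorbs =
  (_ , x≢0 , x∈T) , T⊆Δ , λ x y x≢0 x∈T y∈Δ → x≢0 ∘ m+n≡0⇒m≡0 x , absorbs x y x≢0 x∈T y∈Δ

InJ-conducts : ∀ Δ T {x a} → InJ Δ T → x ≢ 0 → x ∈S T → Conducts Δ a → Conducts T (x + a)
InJ-conducts _ _ {x} {a} (_ , _ , absorbs) x≢0 x∈T conducts z x+a≤z
  with m≤n⇒∃[o]m+o≡n (m+n≤o⇒m≤o x x+a≤z)
... | d , refl = proj₂ (absorbs x d x≢0 x∈T (conducts d (+-cancelˡ-≤ x a d x+a≤z)))

InJ¹-intro : ∀ T {m} → 1 ≤ m → (∀ x → x ∈S T ⇔ (x ≡ 0 ⊎ m ≤ x)) → InJk 1 T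
InJ¹-intro T {m} m≥1 ∈T⇔ =
  ℕˢ , (λ _ → refl) , InJ-intro ℕˢ T (m<n⇒n≢0 m≥1) (from m (inj₂ ≤-refl)) (λ _ _ _ → refl) absorbs
  where
  from : ∀ x → x ≡ 0 ⊎ m ≤ x → x ∈S T
  from x = Equivalence.from (∈T⇔ x)
  absorbs : ∀ x y → x ≢ 0 → x ∈S T → y ∈S ℕˢ → (x + y) ∈S T
  absorbs x y x≢0 x∈T _ with Equivalence.to (∈T⇔ x) x∈T
  ... | inj₁ x≡0 = contradiction x≡0 x≢0
  ... | inj₂ m≤x = from (x + y) (inj₂ (≤-trans m≤x (m≤m+n x y)))

Ordinary⇒InJ¹ : ∀ S → Ordinary S → InJk 1 S
Ordinary⇒InJ¹ S (_ , (m≥1 , _) , ∈S⇔) = InJ¹-intro S m≥1 ∈S⇔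

ordinary-InJ¹ : ∀ {m} → 1 ≤ m → InJk 1 (ordinary m)
ordinary-InJ¹ {m} m≥1 = InJ¹-intro (ordinary m) m≥1 (λ _ → ∈ordinary⇔)

InJ¹⇒Ordinary : ∀ S → InJk 1 S → Ordinary S
InJ¹⇒Ordinary S (Δ , all , S∈JΔ) with multiplicity S
... | m , isM@(m≥1 , m∈S , _) = m , isM , λ x → mk⇔ (to x) (from x)
  where
  conducts : Conducts S (m + 0)
  conducts = InJ-conducts Δ S S∈JΔ (m<n⇒n≢0 m≥1) m∈S (λ z _ → all z)
  to : ∀ x → x ∈S S → x ≡ 0 ⊎ m ≤ x
  to zero    _   = inj₁ refl
  to (suc x) x∈S = inj₂ (≥-multiplicity S isM (λ ()) x∈S)
  from : ∀ x → x ≡ 0 ⊎ m ≤ x → x ∈S S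
  from _ (inj₁ refl) = has-zero S
  from x (inj₂ m≤x)  = conducts x (subst (_≤ x) (sym (+-identityʳ m)) m≤x)

InJ⁰⇒InJ¹ : ∀ S → InJk 0 S → InJk 1 S
InJ⁰⇒InJ¹ S all =
  ℕˢ , (λ _ → refl) , InJ-intro ℕˢ S {1} (λ ()) (all 1) (λ _ _ _ → refl) (λ x y _ _ _ → all (x + y))

InJ<2⇒Ordinary : ∀ S {j} → j < 2 → InJk j S → Ordinary S
InJ<2⇒Ordinary S {0}             _ = InJ¹⇒Ordinary S ∘ InJ⁰⇒InJ¹ S
InJ<2⇒Ordinary S {1}             _ = InJ¹⇒Ordinary S
InJ<2⇒Ordinary S {suc (suc _)} (s≤s (s≤s ()))

-- Here 2 * m unfolds to m + (m + 0), the conductor produced by two applications of InJ-conducts.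
InJ²⇒conducts : ∀ S {m} → IsMultiplicity S m → InJk 2 S → Conducts S (2 * m)
InJ²⇒conducts S {m} (m≥1 , m∈S , _) (Δ , (ℕ′ , all , Δ∈J) , S∈JΔ@(_ , S⊆Δ , _)) =
  InJ-conducts Δ S S∈JΔ m≢0 m∈S (InJ-conducts ℕ′ Δ Δ∈J m≢0 (S⊆Δ _ m≢0 m∈S) (λ z _ → all z))
  where
  m≢0 : m ≢ 0
  m≢0 = m<n⇒n≢0 m≥1

InJ-ordinary : ∀ S {m} → IsMultiplicity S m → Conducts S (2 * m) → InJ (ordinary m) S
InJ-ordinary S {m} isM@(m≥1 , m∈S , _) conducts =
  InJ-intro (ordinary m) S (m<n⇒n≢0 m≥1) m∈S S⊆ absorbs
  where
  S⊆ : ∀ x → x ≢ 0 → x ∈S S → x ∈S ordinary m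
  S⊆ x x≢0 x∈S = Equivalence.from ∈ordinary⇔ (inj₂ (≥-multiplicity S isM x≢0 x∈S))
  absorbs : ∀ x y → x ≢ 0 → x ∈S S → y ∈S ordinary m → (x + y) ∈S S
  absorbs x y x≢0 x∈S y∈ with Equivalence.to (∈ordinary⇔ {m} {y}) y∈
  ... | inj₁ refl = subst (_∈S S) (sym (+-identityʳ x)) x∈S
  ... | inj₂ m≤y  = conducts (x + y)
    (+-mono-≤ (≥-multiplicity S isM x≢0 x∈S) (subst (_≤ y) (sym (+-identityʳ m)) m≤y))

proposition20 : (S : NumericalSemigroup) → HasComplexity S 2 ⇔ (Elementary S × ¬ Ordinary S)
proposition20 S = mk⇔ elementary-nonordinary complexity-two
  where
  elementary-nonordinary : HasComplexity S 2 → Elementary S × ¬ Ordinary S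
  elementary-nonordinary (S∈J² , not-lower) with multiplicity S | frobenius S
  ... | m , isM | f , isF@(f∉S , _) =
    (m , f , isM , isF , gap<conductor S (InJ²⇒conducts S isM S∈J²) f∉S) ,
    not-lower 1 (s≤s (s≤s z≤n)) ∘ Ordinary⇒InJ¹ S
  complexity-two : Elementary S × ¬ Ordinary S → HasComplexity S 2
  complexity-two ((m , _ , isM@(m≥1 , _) , isF , f<2m) , ¬ordinary) =
    (ordinary m , ordinary-InJ¹ m≥1 , InJ-ordinary S isM (Frobenius<⇒conducts S isF f<2m)) ,
    λ _ j<2 → ¬ordinary ∘ InJ<2⇒Ordinary S j<2
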